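{- Let $\mathcal T$ be a strong monad on a symmetric monoidal category $\mathcal C$. If $(X,f)$ with $f:X\to\mathcal TY$ is a central cone of $\mathcal T$ at $Y$, then for every morphism $g:Y\to Z$ the pair $(X,\mathcal Tg\circ f)$ is a central cone of $\mathcal T$ at $Z$.
   Context: For a strong monad $(\mathcal T,\eta,\mu,\tau)$ on a symmetric monoidal category $(\mathcal C,\otimes,I,\gamma)$ with right strength $\tau'_{X,Y}=\mathcal T(\gamma_{Y,X})\circ\tau_{Y,X}\circ\gamma_{\mathcal TX,Y}$, a central cone of $\mathcal T$ at an object $X$ is a pair $(Z,\iota)$ with $\iota:Z\to\mathcal TX$ such that for every object $Y$, $\mu_{X\otimes Y}\circ\mathcal T\tau'_{X,Y}\circ\tau_{\mathcal TX,Y}\circ(\iota\otimes\mathrm{id}_{\mathcal TY})=\mu_{X\otimes Y}\circ\mathcal T\tau_{X,Y}\circ\tau'_{X,\mathcal TY}\circ(\iota\otimes\mathrm{id}_{\mathcal TY})$. -}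

module Defs where

open import Level using (Level; _⊔_; suc)
open import Relation.Binary using (IsEquivalence)

record Category (o ℓ e : Level) : Set (suc (o ⊔ ℓ ⊔ e)) where
  infix  4 _≈_ _⇒_
  infixr 9 _∘_
  field
    Obj       : Set o
    _⇒_       : Obj → Obj → Set ℓ
    _≈_       : ∀ {A B} → (A ⇒ B) → (A ⇒ B) → Set e
    id        : ∀ {A} → A ⇒ A
    _∘_       : ∀ {A B C} → (B ⇒ C) → (A ⇒ B) → (A ⇒ C)
    equiv     : ∀ {A B} → IsEquivalence (_≈_ {A} {B})
    assoc     : ∀ {A B C D} {f : A ⇒ B} {g : B ⇒ C} {h : C ⇒ D} →
                (h ∘ g) ∘ f ≈ h ∘ (g ∘ f)
    identityˡ : ∀ {A B} {f : A ⇒ B} → id ∘ f ≈ f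
    identityʳ : ∀ {A B} {f : A ⇒ B} → f ∘ id ≈ f
    ∘-resp-≈  : ∀ {A B C} {f h : B ⇒ C} {g i : A ⇒ B} →
                f ≈ h → g ≈ i → f ∘ g ≈ h ∘ i

record SymmetricMonoidalCategory (o ℓ e : Level) : Set (suc (o ⊔ ℓ ⊔ e)) where
  field
    category : Category o ℓ e
  open Category category
  infixr 10 _⊗₀_ _⊗₁_
  field
    _⊗₀_ : Obj → Obj → Obj
    _⊗₁_ : ∀ {A B C D} → (A ⇒ B) → (C ⇒ D) → (A ⊗₀ C ⇒ B ⊗₀ D)
    ⊗-identity : ∀ {A B} → id {A} ⊗₁ id {B} ≈ id
    ⊗-homomorphism : ∀ {A B C D E F} {f : A ⇒ B} {g : B ⇒ C} {h : D ⇒ E} {i : E ⇒ F} →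
                     (g ∘ f) ⊗₁ (i ∘ h) ≈ (g ⊗₁ i) ∘ (f ⊗₁ h)
    ⊗-resp-≈ : ∀ {A B C D} {f f' : A ⇒ B} {g g' : C ⇒ D} →
               f ≈ f' → g ≈ g' → f ⊗₁ g ≈ f' ⊗₁ g'
    unit : Obj
    α⇒ : ∀ {X Y Z} → (X ⊗₀ Y) ⊗₀ Z ⇒ X ⊗₀ (Y ⊗₀ Z)
    α⇐ : ∀ {X Y Z} → X ⊗₀ (Y ⊗₀ Z) ⇒ (X ⊗₀ Y) ⊗₀ Z
    α-isoˡ : ∀ {X Y Z} → α⇐ {X} {Y} {Z} ∘ α⇒ ≈ id
    α-isoʳ : ∀ {X Y Z} → α⇒ {X} {Y} {Z} ∘ α⇐ ≈ id
    α-natural : ∀ {X X' Y Y' Z Z'} {f : X ⇒ X'} {g : Y ⇒ Y'} {h : Z ⇒ Z'} →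
                α⇒ ∘ ((f ⊗₁ g) ⊗₁ h) ≈ (f ⊗₁ (g ⊗₁ h)) ∘ α⇒
    λ⇒ : ∀ {X} → unit ⊗₀ X ⇒ X
    λ⇐ : ∀ {X} → X ⇒ unit ⊗₀ X
    λ-isoˡ : ∀ {X} → λ⇐ {X} ∘ λ⇒ ≈ id
    λ-isoʳ : ∀ {X} → λ⇒ {X} ∘ λ⇐ ≈ id
    λ-natural : ∀ {X Y} {f : X ⇒ Y} → λ⇒ ∘ (id ⊗₁ f) ≈ f ∘ λ⇒
    ρ⇒ : ∀ {X} → X ⊗₀ unit ⇒ X
    ρ⇐ : ∀ {X} → X ⇒ X ⊗₀ unit
    ρ-isoˡ : ∀ {X} → ρ⇐ {X} ∘ ρ⇒ ≈ id
    ρ-isoʳ : ∀ {X} → ρ⇒ {X} ∘ ρ⇐ ≈ id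
    ρ-natural : ∀ {X Y} {f : X ⇒ Y} → ρ⇒ ∘ (f ⊗₁ id) ≈ f ∘ ρ⇒
    triangle : ∀ {X Y} → (id {X} ⊗₁ λ⇒ {Y}) ∘ α⇒ ≈ ρ⇒ ⊗₁ id
    pentagon : ∀ {W X Y Z} →
               (id {W} ⊗₁ α⇒ {X} {Y} {Z}) ∘ (α⇒ ∘ (α⇒ ⊗₁ id)) ≈ α⇒ ∘ α⇒
    γ : ∀ {X Y} → X ⊗₀ Y ⇒ Y ⊗₀ X
    γ-natural : ∀ {X X' Y Y'} {f : X ⇒ X'} {g : Y ⇒ Y'} →
                γ ∘ (f ⊗₁ g) ≈ (g ⊗₁ f) ∘ γ
    γ-involutive : ∀ {X Y} → γ {Y} {X} ∘ γ {X} {Y} ≈ id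
    hexagon : ∀ {X Y Z} →
              (id {Y} ⊗₁ γ {X} {Z}) ∘ (α⇒ ∘ (γ ⊗₁ id)) ≈ α⇒ ∘ (γ {X} {Y ⊗₀ Z} ∘ α⇒)

record StrongMonad {o ℓ e : Level} (𝒞 : SymmetricMonoidalCategory o ℓ e)
       : Set (o ⊔ ℓ ⊔ e) where
  open SymmetricMonoidalCategory 𝒞
  open Category category
  field
    T₀ : Obj → Obj
    T₁ : ∀ {A B} → (A ⇒ B) → (T₀ A ⇒ T₀ B)
    T-identity : ∀ {A} → T₁ (id {A}) ≈ id
    T-homomorphism : ∀ {A B C} {f : A ⇒ B} {g : B ⇒ C} → T₁ (g ∘ f) ≈ T₁ g ∘ T₁ f
    T-resp-≈ : ∀ {A B} {f g : A ⇒ B} → f ≈ g → T₁ f ≈ T₁ g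
    η : ∀ {X} → X ⇒ T₀ X
    μ : ∀ {X} → T₀ (T₀ X) ⇒ T₀ X
    η-natural : ∀ {X Y} {f : X ⇒ Y} → η ∘ f ≈ T₁ f ∘ η
    μ-natural : ∀ {X Y} {f : X ⇒ Y} → μ ∘ T₁ (T₁ f) ≈ T₁ f ∘ μ
    μ-assoc : ∀ {X} → μ {X} ∘ T₁ μ ≈ μ ∘ μ
    μ-identityˡ : ∀ {X} → μ {X} ∘ T₁ η ≈ id
    μ-identityʳ : ∀ {X} → μ {X} ∘ η ≈ id
    τ : ∀ {X Y} → X ⊗₀ T₀ Y ⇒ T₀ (X ⊗₀ Y)
    τ-natural : ∀ {X X' Y Y'} {f : X ⇒ X'} {g : Y ⇒ Y'} →
                τ ∘ (f ⊗₁ T₁ g) ≈ T₁ (f ⊗₁ g) ∘ τ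
    τ-unit : ∀ {Y} → T₁ λ⇒ ∘ τ {unit} {Y} ≈ λ⇒
    τ-assoc : ∀ {X Y Z} →
              T₁ (α⇒ {X} {Y} {Z}) ∘ τ ≈ τ ∘ ((id ⊗₁ τ) ∘ α⇒)
    τ-η : ∀ {X Y} → τ {X} {Y} ∘ (id ⊗₁ η) ≈ η
    τ-μ : ∀ {X Y} → τ {X} {Y} ∘ (id ⊗₁ μ) ≈ μ ∘ (T₁ τ ∘ τ)

module _ {o ℓ e : Level} {𝒞 : SymmetricMonoidalCategory o ℓ e} (M : StrongMonad 𝒞) where
  open SymmetricMonoidalCategory 𝒞
  open Category category
  open StrongMonad M

  τ' : ∀ {X Y} → T₀ X ⊗₀ Y ⇒ T₀ (X ⊗₀ Y)
  τ' {X} {Y} = T₁ (γ {Y} {X}) ∘ (τ {Y} {X} ∘ γ {T₀ X} {Y})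

  IsCentralCone : (X Z : Obj) → (ι : Z ⇒ T₀ X) → Set (o ⊔ e)
  IsCentralCone X Z ι = ∀ (Y : Obj) →
    μ {X ⊗₀ Y} ∘ (T₁ (τ' {X} {Y}) ∘ (τ {T₀ X} {Y} ∘ (ι ⊗₁ id {T₀ Y})))
      ≈ μ {X ⊗₀ Y} ∘ (T₁ (τ {X} {Y}) ∘ (τ' {X} {T₀ Y} ∘ (ι ⊗₁ id {T₀ Y})))

module Submission where

-- Both sides of the centrality equation are natural in the object at which the
-- cone lives: postcomposing ι with T g turns each side into T (g ⊗ id) applied to
-- the corresponding side for ι, because τ, τ' and μ are natural. So the equation
-- for ι gives the equation for T g ∘ ι.

open import Level using (Level)
open import Defs
open import Relation.Binary using (IsEquivalence; Setoid)
import Relation.Binary.Reasoning.Setoid as SetoidReasoning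

module CentralCones {o ℓ e : Level} {𝒞 : SymmetricMonoidalCategory o ℓ e} (M : StrongMonad 𝒞) where
  open SymmetricMonoidalCategory 𝒞
  open Category category
  open StrongMonad M
  open module ≈ {A B : Obj} = IsEquivalence (equiv {A} {B})
    using () renaming (refl to ≈-refl; sym to ≈-sym; trans to ≈-trans)

  hom-setoid : Obj → Obj → Setoid ℓ e
  hom-setoid A B = record { Carrier = A ⇒ B ; _≈_ = _≈_ ; isEquivalence = equiv }

  extendʳ : ∀ {A B B' C D} {a : B ⇒ C} {b : A ⇒ B} {c : B' ⇒ C} {d : A ⇒ B'} {x : D ⇒ A} →
            a ∘ b ≈ c ∘ d → a ∘ (b ∘ x) ≈ c ∘ (d ∘ x)
  extendʳ p = ≈-trans (≈-sym assoc) (≈-trans (∘-resp-≈ p ≈-refl) assoc)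

  T-resp-square : ∀ {A B B' C} {a : B ⇒ C} {b : A ⇒ B} {c : B' ⇒ C} {d : A ⇒ B'} →
                  a ∘ b ≈ c ∘ d → T₁ a ∘ T₁ b ≈ T₁ c ∘ T₁ d
  T-resp-square p = ≈-trans (≈-sym T-homomorphism) (≈-trans (T-resp-≈ p) T-homomorphism)

  ⊗-id-homomorphism : ∀ {A B C D} {f : A ⇒ B} {g : B ⇒ C} →
                      (g ∘ f) ⊗₁ id {D} ≈ (g ⊗₁ id) ∘ (f ⊗₁ id)
  ⊗-id-homomorphism = ≈-trans (⊗-resp-≈ ≈-refl (≈-sym identityˡ)) ⊗-homomorphism

  τ-naturalˡ : ∀ {A A' B} {h : A ⇒ A'} → τ {A'} {B} ∘ (h ⊗₁ id) ≈ T₁ (h ⊗₁ id) ∘ τ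
  τ-naturalˡ = ≈-trans (∘-resp-≈ ≈-refl (⊗-resp-≈ ≈-refl (≈-sym T-identity))) τ-natural

  τ'-natural : ∀ {A A' B B'} {g : A ⇒ A'} {h : B ⇒ B'} →
               τ' M ∘ (T₁ g ⊗₁ h) ≈ T₁ (g ⊗₁ h) ∘ τ' M
  τ'-natural {g = g} {h} = begin
      (T₁ γ ∘ (τ ∘ γ)) ∘ (T₁ g ⊗₁ h)  ≈⟨ assoc ⟩
      T₁ γ ∘ ((τ ∘ γ) ∘ (T₁ g ⊗₁ h))  ≈⟨ ∘-resp-≈ ≈-refl assoc ⟩
      T₁ γ ∘ (τ ∘ (γ ∘ (T₁ g ⊗₁ h)))  ≈⟨ ∘-resp-≈ ≈-refl (∘-resp-≈ ≈-refl γ-natural) ⟩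
      T₁ γ ∘ (τ ∘ ((h ⊗₁ T₁ g) ∘ γ))  ≈⟨ ∘-resp-≈ ≈-refl (extendʳ τ-natural) ⟩
      T₁ γ ∘ (T₁ (h ⊗₁ g) ∘ (τ ∘ γ))  ≈⟨ extendʳ (T-resp-square γ-natural) ⟩
      T₁ (g ⊗₁ h) ∘ (T₁ γ ∘ (τ ∘ γ))  ∎
    where open SetoidReasoning (hom-setoid _ _)

  -- A Kleisli composite μ ∘ T t ∘ s of two natural squares is again a natural square.
  μ-T-square : ∀ {A B C D E F G} {s : A ⇒ T₀ B} {t : B ⇒ T₀ C} {u : D ⇒ A} {v : E ⇒ B}
               {w : F ⇒ C} {s₀ : D ⇒ T₀ E} {t₀ : E ⇒ T₀ F} {x : G ⇒ D} →
               s ∘ u ≈ T₁ v ∘ s₀ → t ∘ v ≈ T₁ w ∘ t₀ →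
               μ ∘ (T₁ t ∘ (s ∘ (u ∘ x))) ≈ T₁ w ∘ (μ ∘ (T₁ t₀ ∘ (s₀ ∘ x)))
  μ-T-square {s = s} {t} {u} {v} {w} {s₀} {t₀} {x} p q = begin
      μ ∘ (T₁ t ∘ (s ∘ (u ∘ x)))             ≈⟨ ∘-resp-≈ ≈-refl (∘-resp-≈ ≈-refl (extendʳ p)) ⟩
      μ ∘ (T₁ t ∘ (T₁ v ∘ (s₀ ∘ x)))         ≈⟨ ∘-resp-≈ ≈-refl (extendʳ (T-resp-square q)) ⟩
      μ ∘ (T₁ (T₁ w) ∘ (T₁ t₀ ∘ (s₀ ∘ x)))  ≈⟨ extendʳ μ-natural ⟩
      T₁ w ∘ (μ ∘ (T₁ t₀ ∘ (s₀ ∘ x)))        ∎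
    where open SetoidReasoning (hom-setoid _ _)

  -- The two double strengths T X ⊗ T Y → T (X ⊗ Y) precomposed with ι ⊗ id;
  -- IsCentralCone X Z ι is by definition ∀ Y → dstrˡ ι ≈ dstrʳ ι.
  dstrˡ dstrʳ : ∀ {A X Y} → A ⇒ T₀ X → A ⊗₀ T₀ Y ⇒ T₀ (X ⊗₀ Y)
  dstrˡ ι = μ ∘ (T₁ (τ' M) ∘ (τ ∘ (ι ⊗₁ id)))
  dstrʳ ι = μ ∘ (T₁ τ ∘ (τ' M ∘ (ι ⊗₁ id)))

  dstrˡ-natural : ∀ {A X X' Y} (ι : A ⇒ T₀ X) (g : X ⇒ X') →
                  dstrˡ {Y = Y} (T₁ g ∘ ι) ≈ T₁ (g ⊗₁ id) ∘ dstrˡ ι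
  dstrˡ-natural ι g = ≈-trans
    (∘-resp-≈ ≈-refl (∘-resp-≈ ≈-refl (∘-resp-≈ ≈-refl ⊗-id-homomorphism)))
    (μ-T-square τ-naturalˡ τ'-natural)

  dstrʳ-natural : ∀ {A X X' Y} (ι : A ⇒ T₀ X) (g : X ⇒ X') →
                  dstrʳ {Y = Y} (T₁ g ∘ ι) ≈ T₁ (g ⊗₁ id) ∘ dstrʳ ι
  dstrʳ-natural ι g = ≈-trans
    (∘-resp-≈ ≈-refl (∘-resp-≈ ≈-refl (∘-resp-≈ ≈-refl ⊗-id-homomorphism)))
    (μ-T-square τ'-natural τ-naturalˡ)

  central-T₁-∘ : ∀ {A X X'} (ι : A ⇒ T₀ X) → IsCentralCone M X A ι →
                 (g : X ⇒ X') → IsCentralCone M X' A (T₁ g ∘ ι)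
  central-T₁-∘ ι central g Y = begin
      dstrˡ (T₁ g ∘ ι)          ≈⟨ dstrˡ-natural ι g ⟩
      T₁ (g ⊗₁ id) ∘ dstrˡ ι   ≈⟨ ∘-resp-≈ ≈-refl (central Y) ⟩
      T₁ (g ⊗₁ id) ∘ dstrʳ ι   ≈⟨ ≈-sym (dstrʳ-natural ι g) ⟩
      dstrʳ (T₁ g ∘ ι)          ∎
    where open SetoidReasoning (hom-setoid _ _)

mainTheorem4 : ∀ {o ℓ e : Level} (𝒞 : SymmetricMonoidalCategory o ℓ e) (M : StrongMonad 𝒞)
                 {X Y Z : Category.Obj (SymmetricMonoidalCategory.category 𝒞)}
                 (f : Category._⇒_ (SymmetricMonoidalCategory.category 𝒞) X (StrongMonad.T₀ M Y)) →
                 IsCentralCone M Y X f →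
                 (g : Category._⇒_ (SymmetricMonoidalCategory.category 𝒞) Y Z) →
                 IsCentralCone M Z X
                   (Category._∘_ (SymmetricMonoidalCategory.category 𝒞) (StrongMonad.T₁ M g) f)
mainTheorem4 𝒞 M = CentralCones.central-T₁-∘ M
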